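{- Let $H$ be a connected bipartite graph with $\mathrm{Ev}(Q(H))\subseteq\{0,1,2,3,4,5\}$, and for $r\in\mathbb{R}$ let $m_r$ denote the multiplicity of $r$ as an eigenvalue of $Q(H)$. Then the number of vertices of $H$ is of the form $2^a3^b5^c$ with integers $a,b,c$ satisfying $0\le a\le m_2+2m_4$, $0\le b\le m_3$ and $0\le c\le m_5$.
   Context: $Q(H)=\Delta(H)+A(H)$ is the signless Laplace matrix of $H$ (diagonal degree matrix plus adjacency matrix); $\mathrm{Ev}(M)$ is the set of eigenvalues of $M$. -}

module Defs where

open import Data.Nat as ℕ using (ℕ; zero; suc)
open import Data.Integer as ℤ using (ℤ; +_; _-_; _*_; -_)
open import Data.Bool using (Bool; true; false; if_then_else_)
open import Data.Fin using (Fin; zero; suc; punchIn; toℕ; _≟_)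
open import Relation.Binary.PropositionalEquality using (_≡_; _≢_)
open import Relation.Nullary using (does)
open import Data.Product using (Σ; _×_)

record Graph (n : ℕ) : Set where
  field
    adj    : Fin n → Fin n → Bool
    sym    : ∀ i j → adj i j ≡ adj j i
    irrefl : ∀ i → adj i i ≡ false
open Graph public

data Reachable {n : ℕ} (G : Graph n) : Fin n → Fin n → Set where
  here : ∀ {i} → Reachable G i i
  step : ∀ {i j k} → adj G i j ≡ true → Reachable G j k → Reachable G i k

Connected : {n : ℕ} → Graph n → Set
Connected {n} G = (1 ℕ.≤ n) × (∀ i j → Reachable G i j)

Bipartite : {n : ℕ} → Graph n → Set
Bipartite {n} G = Σ (Fin n → Bool) λ col → ∀ i j → adj G i j ≡ true → col i ≢ col j

sumFin : (n : ℕ) → (Fin n → ℤ) → ℤ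
sumFin zero    f = + 0
sumFin (suc n) f = f zero ℤ.+ sumFin n (λ i → f (suc i))

sumFinℕ : (n : ℕ) → (Fin n → ℕ) → ℕ
sumFinℕ zero    f = 0
sumFinℕ (suc n) f = f zero ℕ.+ sumFinℕ n (λ i → f (suc i))

prodFin : (n : ℕ) → (Fin n → ℤ) → ℤ
prodFin zero    f = + 1
prodFin (suc n) f = f zero * prodFin n (λ i → f (suc i))

Matrix : ℕ → Set
Matrix n = Fin n → Fin n → ℤ

sign : ℕ → ℤ
sign zero = + 1
sign (suc k) = - sign k

det : (n : ℕ) → Matrix n → ℤ
det zero    M = + 1
det (suc n) M = sumFin (suc n) λ j →
  sign (toℕ j) * M zero j * det n (λ i k → M (suc i) (punchIn j k))

b2ℕ : Bool → ℕ
b2ℕ true = 1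
b2ℕ false = 0

degree : {n : ℕ} → Graph n → Fin n → ℕ
degree {n} G i = sumFinℕ n λ j → b2ℕ (adj G i j)

Q : {n : ℕ} → Graph n → Matrix n
Q G i j = (if does (i ≟ j) then + degree G i else + 0) ℤ.+ + b2ℕ (adj G i j)

charPolyAt : (n : ℕ) → Matrix n → ℤ → ℤ
charPolyAt n M t = det n (λ i j → (if does (i ≟ j) then t else + 0) - M i j)

_^ℤ_ : ℤ → ℕ → ℤ
x ^ℤ zero = + 1
x ^ℤ suc k = x * (x ^ℤ k)

-- "Ev(M) ⊆ {0,...,5} with multiplicities m 0, ..., m 5": the characteristic
-- polynomial of M equals ∏_{r=0}^{5} (x - r)^{m r} (as polynomials over ℤ,
-- equivalently as functions ℤ → ℤ).
SpectrumIn0to5 : (n : ℕ) → Matrix n → (Fin 6 → ℕ) → Set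
SpectrumIn0to5 n M m =
  ∀ (t : ℤ) → charPolyAt n M t ≡ prodFin 6 (λ r → (t - + toℕ r) ^ℤ m r)

{-# OPTIONS --safe #-}
-- Colouring the two sides of the bipartition by ±1 gives a vector σ with Qσ = 0, so
-- det(tI - Q) = t·R(t), where R is the determinant with the first row replaced by σ
-- (scaled to start with 1), and R(0) = n·det(-Q₁₁) with Q₁₁ the matrix Q without its
-- first vertex. Conjugated by σ, Q₁₁ is the reduced Laplacian of H, a weakly chained
-- diagonally dominant Z-matrix for connected H, so Chiò condensation shows that its
-- determinant is positive. Comparing t·R(t) with t^(m₀)·∏ᵣ (t - r)^(mᵣ) modulo t forces
-- m₀ = 1 and n·det(-Q₁₁) = ∏ᵣ (-r)^(mᵣ); hence n divides 2^(m₂) 3^(m₃) 4^(m₄) 5^(m₅),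
-- and unique factorisation gives the exponents.
module Submission where

open import Defs hiding (sym)
open import Data.Bool using (Bool; true; false; if_then_else_)
open import Data.Empty using (⊥-elim)
open import Data.Fin using (Fin; zero; suc; punchIn; toℕ; _≟_; fromℕ<; #_)
import Data.Fin.Properties as FinP
open import Data.Nat as ℕ using (ℕ; zero; suc; z≤n; s≤s)
import Data.Nat.Properties as ℕP
import Data.Nat.Tactic.RingSolver as ℕ-Solver
open import Data.Nat.Divisibility using (_∣_; _∣?_; divides; *-cancelˡ-∣; ∣1⇒≡1)
open import Data.Nat.Coprimality using (coprime-divisor)
open import Data.Nat.Primality using (Prime; prime?; prime[2]; prime⇒irreducible; prime⇒nonZero)
open import Data.Product using (Σ; _×_; _,_)
open import Data.Sum using (_⊎_; inj₁; inj₂; [_,_]′)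
open import Data.Vec.Functional using (updateAt)
open import Data.Vec.Functional.Properties using (updateAt-updates; updateAt-minimal; updateAt-id-local; map-updateAt)
open import Function using (const; _∘_)
open import Relation.Binary.PropositionalEquality
open import Relation.Nullary using (Dec; does; yes; no)
open import Relation.Nullary.Decidable using (dec-true; dec-false; from-yes)

module _ where

  open import Data.Integer as ℤ using (ℤ; +_; -[1+_]; 0ℤ; 1ℤ; _+_; _-_; _*_; -_; +≤+; +<+; -<+)
  import Data.Integer.Properties as ℤP
  import Algebra.Properties.AbelianGroup ℤP.+-0-abelianGroup as ℤ+
  open import Data.Integer.Tactic.RingSolver using (solve-∀)

  sumFin-cong : ∀ n {f g : Fin n → ℤ} → (∀ i → f i ≡ g i) → sumFin n f ≡ sumFin n g
  sumFin-cong zero    f≡g = refl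
  sumFin-cong (suc n) f≡g = cong₂ _+_ (f≡g zero) (sumFin-cong n (f≡g ∘ suc))

  sumFin-zero : ∀ n (f : Fin n → ℤ) → (∀ i → f i ≡ 0ℤ) → sumFin n f ≡ 0ℤ
  sumFin-zero zero    f f≡0 = refl
  sumFin-zero (suc n) f f≡0 = cong₂ _+_ (f≡0 zero) (sumFin-zero n (f ∘ suc) (f≡0 ∘ suc))

  sumFin-+ : ∀ n (f g : Fin n → ℤ) → sumFin n (λ i → f i + g i) ≡ sumFin n f + sumFin n g
  sumFin-+ zero    f g = refl
  sumFin-+ (suc n) f g rewrite sumFin-+ n (f ∘ suc) (g ∘ suc) =
    interchange (f zero) (g zero) (sumFin n (f ∘ suc)) (sumFin n (g ∘ suc))
    where
    interchange : ∀ a b c d → a + b + (c + d) ≡ a + c + (b + d)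
    interchange = solve-∀

  sumFin-*ˡ : ∀ n (c : ℤ) (f : Fin n → ℤ) → sumFin n (λ i → c * f i) ≡ c * sumFin n f
  sumFin-*ˡ zero    c f = sym (ℤP.*-zeroʳ c)
  sumFin-*ˡ (suc n) c f rewrite sumFin-*ˡ n c (f ∘ suc) = sym (ℤP.*-distribˡ-+ c (f zero) _)

  sumFin-*ʳ : ∀ n (c : ℤ) (f : Fin n → ℤ) → sumFin n (λ i → f i * c) ≡ sumFin n f * c
  sumFin-*ʳ n c f = begin
    sumFin n (λ i → f i * c) ≡⟨ sumFin-cong n (λ i → ℤP.*-comm (f i) c) ⟩
    sumFin n (λ i → c * f i) ≡⟨ sumFin-*ˡ n c f ⟩
    c * sumFin n f           ≡⟨ ℤP.*-comm c _ ⟩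
    sumFin n f * c           ∎
    where open ≡-Reasoning

  sumFin-neg : ∀ n (f : Fin n → ℤ) → sumFin n (λ i → - f i) ≡ - sumFin n f
  sumFin-neg zero    f = refl
  sumFin-neg (suc n) f rewrite sumFin-neg n (f ∘ suc) = sym (ℤP.neg-distrib-+ (f zero) _)

  sumFin-swap : ∀ m n (f : Fin m → Fin n → ℤ) →
    sumFin m (λ i → sumFin n (f i)) ≡ sumFin n (λ j → sumFin m (λ i → f i j))
  sumFin-swap zero    n f = sym (sumFin-zero n _ (λ _ → refl))
  sumFin-swap (suc m) n f = begin
    sumFin n (f zero) + sumFin m (λ i → sumFin n (f (suc i)))
      ≡⟨ cong (_+_ (sumFin n (f zero))) (sumFin-swap m n (f ∘ suc)) ⟩
    sumFin n (f zero) + sumFin n (λ j → sumFin m (λ i → f (suc i) j))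
      ≡⟨ sumFin-+ n (f zero) _ ⟨
    sumFin n (λ j → sumFin (suc m) (λ i → f i j)) ∎
    where open ≡-Reasoning

  δ : ∀ {n} → Fin n → Fin n → ℤ → ℤ
  δ i j x = if does (i ≟ j) then x else 0ℤ

  δ-≢ : ∀ {n} {i j : Fin n} x → i ≢ j → δ i j x ≡ 0ℤ
  δ-≢ {i = i} {j} x i≢j with i ≟ j
  ... | yes i≡j = ⊥-elim (i≢j i≡j)
  ... | no _    = refl

  δ-0 : ∀ {n} (i j : Fin n) → δ i j 0ℤ ≡ 0ℤ
  δ-0 i j with does (i ≟ j)
  ... | true  = refl
  ... | false = refl

  δ-*ʳ : ∀ {n} (i j : Fin n) x c → δ i j x * c ≡ δ i j (x * c)
  δ-*ʳ i j x c with does (i ≟ j)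
  ... | true  = refl
  ... | false = refl

  δ-*ˡ : ∀ {n} (i j : Fin n) x c → c * δ i j x ≡ δ i j (c * x)
  δ-*ˡ i j x c with does (i ≟ j)
  ... | true  = refl
  ... | false = ℤP.*-zeroʳ c

  sumFin-δˡ : ∀ n (j : Fin n) (f : Fin n → ℤ) → sumFin n (λ i → δ i j (f i)) ≡ f j
  sumFin-δˡ (suc n) zero    f = trans (cong (_+_ (f zero)) (sumFin-zero n _ (λ _ → refl))) (ℤP.+-identityʳ _)
  sumFin-δˡ (suc n) (suc j) f = trans (ℤP.+-identityˡ _) (sumFin-δˡ n j (f ∘ suc))

  sumFin-δʳ : ∀ n (i : Fin n) (f : Fin n → ℤ) → sumFin n (λ j → δ i j (f j)) ≡ f i
  sumFin-δʳ (suc n) zero    f = trans (cong (_+_ (f zero)) (sumFin-zero n _ (λ _ → refl))) (ℤP.+-identityʳ _)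
  sumFin-δʳ (suc n) (suc i) f = trans (ℤP.+-identityˡ _) (sumFin-δʳ n i (f ∘ suc))

  sumFinℕ-ℤ : ∀ n (f : Fin n → ℕ) → + sumFinℕ n f ≡ sumFin n (+_ ∘ f)
  sumFinℕ-ℤ zero    f = refl
  sumFinℕ-ℤ (suc n) f = trans (ℤP.pos-+ (f zero) _) (cong (_+_ (+ f zero)) (sumFinℕ-ℤ n (f ∘ suc)))

  sumFin-const-1 : ∀ n → sumFin n (const 1ℤ) ≡ + n
  sumFin-const-1 zero    = refl
  sumFin-const-1 (suc n) = trans (cong (_+_ 1ℤ) (sumFin-const-1 n)) (sym (ℤP.pos-+ 1 n))

  det-cong : ∀ n {M N : Matrix n} → (∀ i j → M i j ≡ N i j) → det n M ≡ det n N
  det-cong zero    M≡N = refl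
  det-cong (suc n) M≡N = sumFin-cong (suc n) λ j →
    cong₂ (λ a d → sign (toℕ j) * a * d) (M≡N zero j) (det-cong n (λ i k → M≡N (suc i) (punchIn j k)))

  minor : ∀ {n} → Matrix (suc n) → Fin (suc n) → Matrix n
  minor M j i k = M (suc i) (punchIn j k)

  transpose : ∀ {n} → Matrix n → Matrix n
  transpose M i j = M j i

  setRow : ∀ {n} → Matrix n → Fin n → (Fin n → ℤ) → Matrix n
  setRow M r v = updateAt M r (const v)

  det-zeroColumn : ∀ n (M : Matrix (suc n)) → (∀ i → M i zero ≡ 0ℤ) → det (suc n) M ≡ 0ℤ
  det-zeroColumn n M col≡0 = sumFin-zero (suc n) _ (term≡0 n M col≡0)
    where
    term≡0 : ∀ n (M : Matrix (suc n)) → (∀ i → M i zero ≡ 0ℤ) →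
      ∀ j → sign (toℕ j) * M zero j * det n (minor M j) ≡ 0ℤ
    term≡0 n       M col≡0 zero rewrite col≡0 zero = refl
    term≡0 (suc n) M col≡0 (suc j) rewrite det-zeroColumn n (minor M (suc j)) (col≡0 ∘ suc) =
      ℤP.*-zeroʳ (sign (toℕ (suc j)) * M zero (suc j))

  det-zeroBelowPivot : ∀ n (M : Matrix (suc n)) → (∀ i → M (suc i) zero ≡ 0ℤ) →
    det (suc n) M ≡ M zero zero * det n (minor M zero)
  det-zeroBelowPivot n M below≡0 = begin
    1ℤ * M zero zero * det n (minor M zero) + sumFin n (λ j → T (suc j))
      ≡⟨ cong₂ _+_ (cong (_* det n (minor M zero)) (ℤP.*-identityˡ (M zero zero)))
                   (sumFin-zero n (λ j → T (suc j)) (T≡0 n M below≡0)) ⟩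
    M zero zero * det n (minor M zero) + 0ℤ
      ≡⟨ ℤP.+-identityʳ _ ⟩
    M zero zero * det n (minor M zero) ∎
    where
    open ≡-Reasoning
    T : Fin (suc n) → ℤ
    T j = sign (toℕ j) * M zero j * det n (minor M j)
    T≡0 : ∀ n (M : Matrix (suc n)) → (∀ i → M (suc i) zero ≡ 0ℤ) →
      ∀ j → sign (toℕ (suc j)) * M zero (suc j) * det n (minor M (suc j)) ≡ 0ℤ
    T≡0 (suc n) M below≡0 j rewrite det-zeroColumn n (minor M (suc j)) below≡0 =
      ℤP.*-zeroʳ (sign (toℕ (suc j)) * M zero (suc j))

  swap01 : ∀ {k} → Fin (suc (suc k)) → Fin (suc (suc k))
  swap01 zero          = suc zero
  swap01 (suc zero)    = zero
  swap01 (suc (suc c)) = suc (suc c)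

  det-swapColumns01 : ∀ k (M : Matrix (suc (suc k))) →
    det (suc (suc k)) (λ i j → M i (swap01 j)) ≡ - det (suc (suc k)) M
  det-swapColumns01 k M = begin
    f zero + (f (suc zero) + sumFin k (λ j → f (suc (suc j))))
      ≡⟨ cong₂ _+_ f₀≡-g₁ (cong₂ _+_ f₁≡-g₀ (trans (sumFin-cong k (rest k M)) (sumFin-neg k (λ j → g (suc (suc j)))))) ⟩
    - g (suc zero) + (- g zero + - sumFin k (λ j → g (suc (suc j))))
      ≡⟨ regroup (g zero) (g (suc zero)) (sumFin k (λ j → g (suc (suc j)))) ⟩
    - (g zero + (g (suc zero) + sumFin k (λ j → g (suc (suc j))))) ∎
    where
    open ≡-Reasoning
    M′ : Matrix (suc (suc k))
    M′ i j = M i (swap01 j)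
    f g : Fin (suc (suc k)) → ℤ
    f j = sign (toℕ j) * M′ zero j * det (suc k) (minor M′ j)
    g j = sign (toℕ j) * M zero j * det (suc k) (minor M j)
    regroup : ∀ a b c → - b + (- a + - c) ≡ - (a + (b + c))
    regroup = solve-∀
    flip₀ : ∀ a d → 1ℤ * a * d ≡ - (- 1ℤ * a * d)
    flip₀ = solve-∀
    flip₁ : ∀ a d → - 1ℤ * a * d ≡ - (1ℤ * a * d)
    flip₁ = solve-∀
    flipᵣ : ∀ s a d → s * a * (- d) ≡ - (s * a * d)
    flipᵣ = solve-∀
    f₀≡-g₁ : f zero ≡ - g (suc zero)
    f₀≡-g₁ = trans (cong (λ d → 1ℤ * M zero (suc zero) * d)
                     (det-cong (suc k) {M = minor M′ zero} {N = minor M (suc zero)} λ i → λ { zero → refl ; (suc l) → refl }))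
                   (flip₀ (M zero (suc zero)) _)
    f₁≡-g₀ : f (suc zero) ≡ - g zero
    f₁≡-g₀ = trans (cong (λ d → - 1ℤ * M zero zero * d)
                     (det-cong (suc k) {M = minor M′ (suc zero)} {N = minor M zero} λ i → λ { zero → refl ; (suc l) → refl }))
                   (flip₁ (M zero zero) _)
    rest : ∀ k (M : Matrix (suc (suc k))) (j : Fin k) →
      sign (toℕ (suc (suc j))) * M zero (suc (suc j)) * det (suc k) (minor (λ i j → M i (swap01 j)) (suc (suc j)))
      ≡ - (sign (toℕ (suc (suc j))) * M zero (suc (suc j)) * det (suc k) (minor M (suc (suc j))))
    rest (suc k) M j = trans
      (cong (λ d → sign (toℕ (suc (suc j))) * M zero (suc (suc j)) * d)
        (trans (det-cong (suc (suc k)) {M = minor (λ i j → M i (swap01 j)) (suc (suc j))}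
                                       {N = λ i l → minor M (suc (suc j)) i (swap01 l)}
                                       (λ i → λ { zero → refl ; (suc zero) → refl ; (suc (suc l)) → refl }))
               (det-swapColumns01 k (minor M (suc (suc j))))))
      (flipᵣ (sign (toℕ (suc (suc j)))) (M zero (suc (suc j))) _)

  -- Separate from det-transpose so that the recursion there is visibly structural.
  det-transpose-step : ∀ k →
    (∀ (M : Matrix k) → det k (transpose M) ≡ det k M) →
    (∀ (M : Matrix (suc k)) → det (suc k) (transpose M) ≡ det (suc k) M) →
    ∀ (M : Matrix (suc (suc k))) → det (suc (suc k)) (transpose M) ≡ det (suc (suc k)) M
  det-transpose-step k transpose₀ transpose₁ M = begin
    sumFin (suc (suc k)) (λ j → sign (toℕ j) * M j zero * det (suc k) (minor (transpose M) j))
      ≡⟨ sumFin-cong (suc (suc k)) (λ j → cong (λ d → sign (toℕ j) * M j zero * d) (transpose₁ (A j))) ⟩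
    t₀ + sumFin (suc k) (λ j → sign (toℕ (suc j)) * M (suc j) zero *
           sumFin (suc k) (λ l → sign (toℕ l) * M zero (suc l) * det k (E j l)))
      ≡⟨ cong (_+_ t₀) (sumFin-cong (suc k) (λ j → sumFin-*ˡ (suc k) (sign (toℕ (suc j)) * M (suc j) zero)
                                                                  (λ l → sign (toℕ l) * M zero (suc l) * det k (E j l)))) ⟨
    t₀ + sumFin (suc k) (λ j → sumFin (suc k) (λ l → F j l))
      ≡⟨ cong (_+_ t₀) (sumFin-swap (suc k) (suc k) F) ⟩
    t₀ + sumFin (suc k) (λ l → sumFin (suc k) (λ j → F j l))
      ≡⟨ cong (_+_ t₀) (sumFin-cong (suc k) (λ l → sumFin-cong (suc k) (λ j → F≡G j l))) ⟩
    t₀ + sumFin (suc k) (λ l → sumFin (suc k) (λ j → G l j))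
      ≡⟨ cong (_+_ t₀) (sumFin-cong (suc k) (λ l → sumFin-*ˡ (suc k) (sign (toℕ (suc l)) * M zero (suc l))
                                                                  (λ j → sign (toℕ j) * M (suc j) zero * det k (E j l)))) ⟩
    t₀ + sumFin (suc k) (λ l → sign (toℕ (suc l)) * M zero (suc l) *
           sumFin (suc k) (λ j → sign (toℕ j) * M (suc j) zero * det k (E j l)))
      ≡⟨ cong (_+_ t₀) (sumFin-cong (suc k) (λ l → cong (λ d → sign (toℕ (suc l)) * M zero (suc l) * d) (expand l))) ⟩
    det (suc (suc k)) M ∎
    where
    open ≡-Reasoning
    A : Fin (suc (suc k)) → Matrix (suc k)
    A j i l = M (punchIn j i) (suc l)
    E : Fin (suc k) → Fin (suc k) → Matrix k
    E j l a b = M (suc (punchIn j a)) (suc (punchIn l b))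
    t₀ : ℤ
    t₀ = sign 0 * M zero zero * det (suc k) (minor M zero)
    F : Fin (suc k) → Fin (suc k) → ℤ
    F j l = sign (toℕ (suc j)) * M (suc j) zero * (sign (toℕ l) * M zero (suc l) * det k (E j l))
    G : Fin (suc k) → Fin (suc k) → ℤ
    G l j = sign (toℕ (suc l)) * M zero (suc l) * (sign (toℕ j) * M (suc j) zero * det k (E j l))
    commute : ∀ a x b y d → - a * x * (b * y * d) ≡ - b * y * (a * x * d)
    commute = solve-∀
    F≡G : ∀ j l → F j l ≡ G l j
    F≡G j l = commute (sign (toℕ j)) (M (suc j) zero) (sign (toℕ l)) (M zero (suc l)) (det k (E j l))
    expand : ∀ l → sumFin (suc k) (λ j → sign (toℕ j) * M (suc j) zero * det k (E j l))
                   ≡ det (suc k) (minor M (suc l))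
    expand l = trans (sumFin-cong (suc k) (λ j → cong (λ d → sign (toℕ j) * M (suc j) zero * d)
                       (sym (transpose₀ (E j l)))))
                     (transpose₁ (minor M (suc l)))

  det-transpose : ∀ n (M : Matrix n) → det n (transpose M) ≡ det n M
  det-transpose zero          M = refl
  det-transpose (suc zero)    M = refl
  det-transpose (suc (suc k)) M = det-transpose-step k (det-transpose k) (det-transpose (suc k)) M

  det-swapRows01 : ∀ k (M : Matrix (suc (suc k))) →
    det (suc (suc k)) (M ∘ swap01) ≡ - det (suc (suc k)) M
  det-swapRows01 k M = begin
    det (suc (suc k)) (M ∘ swap01)                       ≡⟨ det-transpose (suc (suc k)) (M ∘ swap01) ⟨
    det (suc (suc k)) (λ i j → transpose M i (swap01 j)) ≡⟨ det-swapColumns01 k (transpose M) ⟩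
    - det (suc (suc k)) (transpose M)                    ≡⟨ cong -_ (det-transpose (suc (suc k)) M) ⟩
    - det (suc (suc k)) M                                ∎
    where open ≡-Reasoning

  det-equalRows : ∀ k (M : Matrix (suc k)) (r : Fin k) → (∀ j → M (suc r) j ≡ M zero j) → det (suc k) M ≡ 0ℤ
  det-equalRows (suc k) M zero    M₁≡M₀ = self-negation (begin
    det (suc (suc k)) M            ≡⟨ det-cong (suc (suc k)) {M = M} {N = M ∘ swap01}
                                        (λ { zero j → sym (M₁≡M₀ j) ; (suc zero) j → M₁≡M₀ j ; (suc (suc i)) j → refl }) ⟩
    det (suc (suc k)) (M ∘ swap01) ≡⟨ det-swapRows01 k M ⟩
    - det (suc (suc k)) M          ∎)
    where
    open ≡-Reasoning
    self-negation : ∀ {x} → x ≡ - x → x ≡ 0ℤ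
    self-negation {+ zero} _ = refl
  det-equalRows (suc k) M (suc r) Mᵣ≡M₀ = begin
    det (suc (suc k)) M              ≡⟨ ℤP.neg-involutive _ ⟨
    - - det (suc (suc k)) M          ≡⟨ cong -_ (det-swapRows01 k M) ⟨
    - det (suc (suc k)) (M ∘ swap01) ≡⟨ cong -_ (sumFin-zero (suc (suc k)) _ λ j →
         trans (cong (λ d → sign (toℕ j) * M (suc zero) j * d)
                  (det-equalRows k (minor (M ∘ swap01) j) r (λ l → Mᵣ≡M₀ (punchIn j l))))
               (ℤP.*-zeroʳ (sign (toℕ j) * M (suc zero) j))) ⟩
    0ℤ                               ∎
    where open ≡-Reasoning

  setRow-self : ∀ {n} (M : Matrix n) r i j → setRow M r (M r) i j ≡ M i j
  setRow-self M r i = cong-app (updateAt-id-local r M refl i)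

  minor-setRow : ∀ {n} (M : Matrix (suc n)) r (v : Fin (suc n) → ℤ) j i k →
    minor (setRow M (suc r) v) j i k ≡ setRow (minor M j) r (v ∘ punchIn j) i k
  minor-setRow M r v j i = cong-app (map-updateAt {f = λ row → row ∘ punchIn j} (λ _ → refl) (M ∘ suc) r i)

  det-setRow-linear : ∀ n (M : Matrix n) r (a b : ℤ) (u w : Fin n → ℤ) →
    det n (setRow M r (λ j → a * u j + b * w j)) ≡ a * det n (setRow M r u) + b * det n (setRow M r w)
  det-setRow-linear (suc n) M zero a b u w = begin
    sumFin (suc n) (λ j → sign (toℕ j) * (a * u j + b * w j) * D j)
      ≡⟨ sumFin-cong (suc n) (λ j → distribute (sign (toℕ j)) a b (u j) (w j) (D j)) ⟩
    sumFin (suc n) (λ j → a * T u j + b * T w j)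
      ≡⟨ sumFin-+ (suc n) (λ j → a * T u j) (λ j → b * T w j) ⟩
    sumFin (suc n) (λ j → a * T u j) + sumFin (suc n) (λ j → b * T w j)
      ≡⟨ cong₂ _+_ (sumFin-*ˡ (suc n) a (T u)) (sumFin-*ˡ (suc n) b (T w)) ⟩
    a * det (suc n) (setRow M zero u) + b * det (suc n) (setRow M zero w) ∎
    where
    open ≡-Reasoning
    D : Fin (suc n) → ℤ
    D j = det n (minor M j)
    T : (Fin (suc n) → ℤ) → Fin (suc n) → ℤ
    T v j = sign (toℕ j) * v j * D j
    distribute : ∀ s a b x y d → s * (a * x + b * y) * d ≡ a * (s * x * d) + b * (s * y * d)
    distribute = solve-∀
  det-setRow-linear (suc n) M (suc r) a b u w = begin
    sumFin (suc n) (λ j → c j * det n (minor (setRow M (suc r) (λ j → a * u j + b * w j)) j))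
      ≡⟨ sumFin-cong (suc n) (λ j → cong (c j *_)
           (trans (det-cong n (minor-setRow M r (λ j → a * u j + b * w j) j))
                  (det-setRow-linear n (minor M j) r a b (u ∘ punchIn j) (w ∘ punchIn j)))) ⟩
    sumFin (suc n) (λ j → c j * (a * X u j + b * X w j))
      ≡⟨ sumFin-cong (suc n) (λ j → distribute (c j) a b (X u j) (X w j)) ⟩
    sumFin (suc n) (λ j → a * (c j * X u j) + b * (c j * X w j))
      ≡⟨ sumFin-+ (suc n) (λ j → a * (c j * X u j)) (λ j → b * (c j * X w j)) ⟩
    sumFin (suc n) (λ j → a * (c j * X u j)) + sumFin (suc n) (λ j → b * (c j * X w j))
      ≡⟨ cong₂ _+_ (trans (sumFin-*ˡ (suc n) a (λ j → c j * X u j)) (cong (a *_) (expand u)))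
                   (trans (sumFin-*ˡ (suc n) b (λ j → c j * X w j)) (cong (b *_) (expand w))) ⟩
    a * det (suc n) (setRow M (suc r) u) + b * det (suc n) (setRow M (suc r) w) ∎
    where
    open ≡-Reasoning
    c : Fin (suc n) → ℤ
    c j = sign (toℕ j) * M zero j
    X : (Fin (suc n) → ℤ) → Fin (suc n) → ℤ
    X v j = det n (setRow (minor M j) r (v ∘ punchIn j))
    expand : ∀ v → sumFin (suc n) (λ j → c j * X v j) ≡ det (suc n) (setRow M (suc r) v)
    expand v = sumFin-cong (suc n) (λ j → cong (c j *_) (sym (det-cong n (minor-setRow M r v j))))
    distribute : ∀ c a b x y → c * (a * x + b * y) ≡ a * (c * x) + b * (c * y)
    distribute = solve-∀

  det-addRow : ∀ n (M : Matrix (suc n)) (i : Fin n) (p c : ℤ) →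
    det (suc n) (setRow M (suc i) (λ j → p * M (suc i) j + c * M zero j)) ≡ p * det (suc n) M
  det-addRow n M i p c = begin
    det (suc n) (setRow M (suc i) (λ j → p * M (suc i) j + c * M zero j))
      ≡⟨ det-setRow-linear (suc n) M (suc i) p c (M (suc i)) (M zero) ⟩
    p * det (suc n) (setRow M (suc i) (M (suc i))) + c * det (suc n) (setRow M (suc i) (M zero))
      ≡⟨ cong₂ (λ x y → p * x + c * y) (det-cong (suc n) (setRow-self M (suc i)))
               (det-equalRows n (setRow M (suc i) (M zero)) i (λ j → cong-app (updateAt-updates (suc i) M) j)) ⟩
    p * det (suc n) M + c * 0ℤ ≡⟨ cong (_+_ (p * det (suc n) M)) (ℤP.*-zeroʳ c) ⟩
    p * det (suc n) M + 0ℤ     ≡⟨ ℤP.+-identityʳ _ ⟩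
    p * det (suc n) M          ∎
    where open ≡-Reasoning

  det-setRow₀-combination : ∀ n (M : Matrix (suc n)) (c : Fin (suc n) → ℤ) →
    det (suc n) (setRow M zero (λ j → sumFin (suc n) (λ i → c i * M i j))) ≡ c zero * det (suc n) M
  det-setRow₀-combination n M c = begin
    sumFin (suc n) (λ j → sign (toℕ j) * sumFin (suc n) (λ i → c i * M i j) * D j)
      ≡⟨ sumFin-cong (suc n) (λ j → trans (cong (_* D j) (sym (sumFin-*ˡ (suc n) (sign (toℕ j)) (λ i → c i * M i j))))
                                          (sym (sumFin-*ʳ (suc n) (D j) (λ i → sign (toℕ j) * (c i * M i j))))) ⟩
    sumFin (suc n) (λ j → sumFin (suc n) (λ i → T i j))
      ≡⟨ sumFin-swap (suc n) (suc n) (λ j i → T i j) ⟩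
    sumFin (suc n) (λ i → sumFin (suc n) (λ j → T i j))
      ≡⟨ sumFin-cong (suc n) (λ i → trans (sumFin-cong (suc n) (λ j → pull (sign (toℕ j)) (c i) (M i j) (D j)))
                                          (sumFin-*ˡ (suc n) (c i) (λ j → sign (toℕ j) * M i j * D j))) ⟩
    sumFin (suc n) (λ i → c i * det (suc n) (setRow M zero (M i)))
      ≡⟨ cong₂ _+_ (cong (c zero *_) (det-cong (suc n) (setRow-self M zero)))
                   (sumFin-zero n (λ i → c (suc i) * det (suc n) (setRow M zero (M (suc i))))
                     (λ i → trans (cong (c (suc i) *_) (det-equalRows n (setRow M zero (M (suc i))) i (λ _ → refl)))
                                  (ℤP.*-zeroʳ (c (suc i))))) ⟩
    c zero * det (suc n) M + 0ℤ ≡⟨ ℤP.+-identityʳ _ ⟩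
    c zero * det (suc n) M      ∎
    where
    open ≡-Reasoning
    D : Fin (suc n) → ℤ
    D j = det n (minor M j)
    T : Fin (suc n) → Fin (suc n) → ℤ
    T i j = sign (toℕ j) * (c i * M i j) * D j
    pull : ∀ s c m d → s * (c * m) * d ≡ c * (s * m * d)
    pull = solve-∀

  det-scaleRows : ∀ n (M : Matrix n) (s : Fin n → ℤ) → det n (λ i j → s i * M i j) ≡ prodFin n s * det n M
  det-scaleRows zero    M s = refl
  det-scaleRows (suc n) M s = begin
    sumFin (suc n) (λ j → sign (toℕ j) * (s zero * M zero j) * det n (λ i k → s (suc i) * M (suc i) (punchIn j k)))
      ≡⟨ sumFin-cong (suc n) (λ j → trans (cong (λ d → sign (toℕ j) * (s zero * M zero j) * d)
                                               (det-scaleRows n (minor M j) (s ∘ suc)))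
                                          (pull (sign (toℕ j)) (s zero) (M zero j) P (det n (minor M j)))) ⟩
    sumFin (suc n) (λ j → (s zero * P) * (sign (toℕ j) * M zero j * det n (minor M j)))
      ≡⟨ sumFin-*ˡ (suc n) (s zero * P) (λ j → sign (toℕ j) * M zero j * det n (minor M j)) ⟩
    (s zero * P) * det (suc n) M ∎
    where
    open ≡-Reasoning
    P : ℤ
    P = prodFin n (s ∘ suc)
    pull : ∀ g a m p d → g * (a * m) * (p * d) ≡ (a * p) * (g * m * d)
    pull = solve-∀

  det-scaleColumns : ∀ n (M : Matrix n) (s : Fin n → ℤ) → det n (λ i j → M i j * s j) ≡ prodFin n s * det n M
  det-scaleColumns n M s = begin
    det n (λ i j → M i j * s j)           ≡⟨ det-transpose n (λ i j → M i j * s j) ⟨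
    det n (λ i j → M j i * s i)           ≡⟨ det-cong n (λ i j → ℤP.*-comm (M j i) (s i)) ⟩
    det n (λ i j → s i * transpose M i j) ≡⟨ det-scaleRows n (transpose M) s ⟩
    prodFin n s * det n (transpose M)     ≡⟨ cong (prodFin n s *_) (det-transpose n M) ⟩
    prodFin n s * det n M                 ∎
    where open ≡-Reasoning

  *-nonNeg : ∀ {a b} → 0ℤ ℤ.≤ a → 0ℤ ℤ.≤ b → 0ℤ ℤ.≤ a * b
  *-nonNeg (+≤+ {n = m} _) (+≤+ {n = n} _) = subst (0ℤ ℤ.≤_) (ℤP.pos-* m n) (+≤+ z≤n)

  *-pos : ∀ {a b} → 0ℤ ℤ.< a → 0ℤ ℤ.< b → 0ℤ ℤ.< a * b
  *-pos (+<+ (s≤s _)) (+<+ (s≤s _)) = +<+ (s≤s z≤n)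

  ^-pos : ∀ {a} k → 0ℤ ℤ.< a → 0ℤ ℤ.< a ^ℤ k
  ^-pos zero    _   = +<+ (s≤s z≤n)
  ^-pos (suc k) 0<a = *-pos 0<a (^-pos k 0<a)

  *-pos-cancelˡ : ∀ {a} b → 0ℤ ℤ.< a → 0ℤ ℤ.< a * b → 0ℤ ℤ.< b
  *-pos-cancelˡ (+ suc n)  _             _ = +<+ (s≤s z≤n)
  *-pos-cancelˡ {a} (+ zero) _        0<ab = ⊥-elim (ℤP.<-irrefl refl (subst (0ℤ ℤ.<_) (ℤP.*-zeroʳ a) 0<ab))
  *-pos-cancelˡ -[1+ n ]   (+<+ (s≤s _)) ()

  sumFin-nonNeg : ∀ n (f : Fin n → ℤ) → (∀ i → 0ℤ ℤ.≤ f i) → 0ℤ ℤ.≤ sumFin n f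
  sumFin-nonNeg zero    f 0≤f = +≤+ z≤n
  sumFin-nonNeg (suc n) f 0≤f = ℤP.+-mono-≤ (0≤f zero) (sumFin-nonNeg n (f ∘ suc) (0≤f ∘ suc))

  sumFin-pos : ∀ n (f : Fin n → ℤ) → (∀ i → 0ℤ ℤ.≤ f i) → ∀ j → 0ℤ ℤ.< f j → 0ℤ ℤ.< sumFin n f
  sumFin-pos (suc n) f 0≤f zero    0<fj = ℤP.+-mono-<-≤ 0<fj (sumFin-nonNeg n (f ∘ suc) (0≤f ∘ suc))
  sumFin-pos (suc n) f 0≤f (suc j) 0<fj = ℤP.+-mono-≤-< (0≤f zero) (sumFin-pos n (f ∘ suc) (0≤f ∘ suc) j 0<fj)

  module Condensation {k : ℕ} (M : Matrix (suc k)) where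

    pivot : ℤ
    pivot = M zero zero

    eliminate : Fin k → Fin (suc k) → ℤ
    eliminate i j = pivot * M (suc i) j + (- M (suc i) zero) * M zero j

    condensed : Matrix k
    condensed i j = eliminate i (suc j)

    eliminatedBelow : ℕ → Matrix (suc k)
    eliminatedBelow m zero    = M zero
    eliminatedBelow m (suc i) = if does (toℕ i ℕ.<? m) then eliminate i else M (suc i)

    eliminatedBelow-0 : ∀ i j → eliminatedBelow 0 i j ≡ M i j
    eliminatedBelow-0 zero    j = refl
    eliminatedBelow-0 (suc i) j = refl

    eliminatedBelow-k : ∀ i j → eliminatedBelow k (suc i) j ≡ eliminate i j
    eliminatedBelow-k i j rewrite dec-true (toℕ i ℕ.<? k) (FinP.toℕ<n i) = refl

    eliminatedBelow-suc : ∀ m (m<k : m ℕ.< k) → let i₀ = fromℕ< m<k in ∀ i j →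
      eliminatedBelow (suc m) i j ≡
        setRow (eliminatedBelow m) (suc i₀)
          (λ j → pivot * eliminatedBelow m (suc i₀) j + (- M (suc i₀) zero) * eliminatedBelow m zero j) i j
    eliminatedBelow-suc m m<k zero    j = refl
    eliminatedBelow-suc m m<k (suc i) j with i ≟ fromℕ< m<k
    ... | yes refl rewrite FinP.toℕ-fromℕ< m<k
                         | dec-true  (m ℕ.<? suc m) (ℕP.n<1+n m)
                         | dec-false (m ℕ.<? m) (ℕP.<-irrefl refl) =
      sym (cong-app (updateAt-updates (suc (fromℕ< m<k)) (eliminatedBelow m)) j)
    ... | no i≢i₀ = trans (cong (λ b → (if b then eliminate i else M (suc i)) j) (same-threshold (toℕ i) i≢m))
                          (sym (cong-app (updateAt-minimal (suc i) (suc (fromℕ< m<k)) (eliminatedBelow m) (i≢i₀ ∘ FinP.suc-injective)) j))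
      where
      i≢m : toℕ i ≢ m
      i≢m i≡m = i≢i₀ (FinP.toℕ-injective (trans i≡m (sym (FinP.toℕ-fromℕ< m<k))))
      same-threshold : ∀ x → x ≢ m → does (x ℕ.<? suc m) ≡ does (x ℕ.<? m)
      same-threshold x x≢m with x ℕ.<? m
      ... | yes x<m = trans (dec-true (x ℕ.<? suc m) (ℕP.m<n⇒m<1+n x<m)) (sym (dec-true (x ℕ.<? m) x<m))
      ... | no x≮m  = trans (dec-false (x ℕ.<? suc m) (λ x<1+m → x≢m (ℕP.≤-antisym (ℕP.≤-pred x<1+m) (ℕP.≮⇒≥ x≮m))))
                            (sym (dec-false (x ℕ.<? m) x≮m))

    det-eliminatedBelow : ∀ m → m ℕ.≤ k → det (suc k) (eliminatedBelow m) ≡ pivot ^ℤ m * det (suc k) M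
    det-eliminatedBelow zero    _   = trans (det-cong (suc k) eliminatedBelow-0) (sym (ℤP.*-identityˡ _))
    det-eliminatedBelow (suc m) m<k = begin
      det (suc k) (eliminatedBelow (suc m))
        ≡⟨ det-cong (suc k) (eliminatedBelow-suc m m<k) ⟩
      det (suc k) (setRow (eliminatedBelow m) (suc i₀)
                     (λ j → pivot * eliminatedBelow m (suc i₀) j + (- M (suc i₀) zero) * eliminatedBelow m zero j))
        ≡⟨ det-addRow k (eliminatedBelow m) i₀ pivot (- M (suc i₀) zero) ⟩
      pivot * det (suc k) (eliminatedBelow m)     ≡⟨ cong (pivot *_) (det-eliminatedBelow m (ℕP.<⇒≤ m<k)) ⟩
      pivot * (pivot ^ℤ m * det (suc k) M)        ≡⟨ ℤP.*-assoc pivot (pivot ^ℤ m) _ ⟨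
      pivot * pivot ^ℤ m * det (suc k) M          ∎
      where
      open ≡-Reasoning
      i₀ : Fin k
      i₀ = fromℕ< m<k

    det-condensation : pivot ^ℤ k * det (suc k) M ≡ pivot * det k condensed
    det-condensation = begin
      pivot ^ℤ k * det (suc k) M                    ≡⟨ det-eliminatedBelow k ℕP.≤-refl ⟨
      det (suc k) (eliminatedBelow k)               ≡⟨ det-zeroBelowPivot k (eliminatedBelow k) below≡0 ⟩
      pivot * det k (minor (eliminatedBelow k) zero) ≡⟨ cong (pivot *_) (det-cong k (λ i j → eliminatedBelow-k i (suc j))) ⟩
      pivot * det k condensed                       ∎
      where
      open ≡-Reasoning
      cancel : ∀ p a → p * a + (- a) * p ≡ 0ℤ
      cancel = solve-∀
      below≡0 : ∀ i → eliminatedBelow k (suc i) zero ≡ 0ℤ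
      below≡0 i = trans (eliminatedBelow-k i zero) (cancel pivot (M (suc i) zero))

  OffDiagonalNonPositive : ∀ {k} → Matrix k → Set
  OffDiagonalNonPositive {k} M = ∀ (i j : Fin k) → i ≢ j → M i j ℤ.≤ 0ℤ

  RowSumsNonNegative : ∀ {k} → Matrix k → Set
  RowSumsNonNegative {k} M = ∀ i → 0ℤ ℤ.≤ sumFin k (M i)

  data LinkedToDominantRow {k} (M : Matrix k) : Fin k → Set where
    dominant : ∀ {i} → 0ℤ ℤ.< sumFin k (M i) → LinkedToDominantRow M i
    link     : ∀ {i} j → M i j ℤ.< 0ℤ → LinkedToDominantRow M j → LinkedToDominantRow M i

  module CondensationSigns {k : ℕ} (M : Matrix (suc k))
                           (off : OffDiagonalNonPositive M) (rows : RowSumsNonNegative M) where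
    open Condensation M

    0≤-M : ∀ {i j} → i ≢ j → 0ℤ ℤ.≤ - M i j
    0≤-M i≢j = ℤP.neg-mono-≤ (off _ _ i≢j)

    offPivotRow : ℤ
    offPivotRow = sumFin k (λ j → - M zero (suc j))

    pivot≡ : pivot ≡ sumFin (suc k) (M zero) + offPivotRow
    pivot≡ = begin
      pivot                                                           ≡⟨ split pivot Y ⟩
      (pivot + Y) + - Y                                               ≡⟨ cong (_+_ (pivot + Y)) (sumFin-neg k (λ j → M zero (suc j))) ⟨
      sumFin (suc k) (M zero) + offPivotRow                           ∎
      where
      open ≡-Reasoning
      Y : ℤ
      Y = sumFin k (λ j → M zero (suc j))
      split : ∀ a b → a ≡ (a + b) + - b
      split = solve-∀

    offPivotRow-nonNeg : 0ℤ ℤ.≤ offPivotRow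
    offPivotRow-nonNeg = sumFin-nonNeg k _ (λ j → 0≤-M (λ ()))

    pivot-nonNeg : 0ℤ ℤ.≤ pivot
    pivot-nonNeg = subst (0ℤ ℤ.≤_) (sym pivot≡) (ℤP.+-mono-≤ (rows zero) offPivotRow-nonNeg)

    pivot-pos : LinkedToDominantRow M zero → 0ℤ ℤ.< pivot
    pivot-pos (dominant 0<row) = subst (0ℤ ℤ.<_) (sym pivot≡) (ℤP.+-mono-<-≤ 0<row offPivotRow-nonNeg)
    pivot-pos (link zero M₀₀<0 _) = ⊥-elim (ℤP.<⇒≱ M₀₀<0 pivot-nonNeg)
    pivot-pos (link (suc j) M₀ⱼ<0 _) = subst (0ℤ ℤ.<_) (sym pivot≡) (ℤP.+-mono-≤-< (rows zero)
      (sumFin-pos k _ (λ j → 0≤-M (λ ())) j (ℤP.neg-mono-< M₀ⱼ<0)))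

    -condensed≡ : ∀ i j → - condensed i j ≡ pivot * (- M (suc i) (suc j)) + (- M (suc i) zero) * (- M zero (suc j))
    -condensed≡ i j = negate pivot (M (suc i) (suc j)) (M (suc i) zero) (M zero (suc j))
      where
      negate : ∀ p x a b → - (p * x + (- a) * b) ≡ p * (- x) + (- a) * (- b)
      negate = solve-∀

    condensed-offDiagonal : OffDiagonalNonPositive condensed
    condensed-offDiagonal i j i≢j = ℤP.neg-cancel-≤ (subst (0ℤ ℤ.≤_) (sym (-condensed≡ i j))
      (ℤP.+-mono-≤ (*-nonNeg pivot-nonNeg (0≤-M (i≢j ∘ FinP.suc-injective)))
                   (*-nonNeg (0≤-M (λ ())) (0≤-M (λ ())))))

    rowSum-condensed : ∀ i → sumFin k (condensed i)
                            ≡ pivot * sumFin (suc k) (M (suc i)) + (- M (suc i) zero) * sumFin (suc k) (M zero)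
    rowSum-condensed i = begin
      sumFin k (condensed i)
        ≡⟨ sumFin-+ k (λ j → pivot * M (suc i) (suc j)) (λ j → (- M (suc i) zero) * M zero (suc j)) ⟩
      sumFin k (λ j → pivot * M (suc i) (suc j)) + sumFin k (λ j → (- M (suc i) zero) * M zero (suc j))
        ≡⟨ cong₂ _+_ (sumFin-*ˡ k pivot (λ j → M (suc i) (suc j))) (sumFin-*ˡ k (- M (suc i) zero) (λ j → M zero (suc j))) ⟩
      pivot * sumFin k (λ j → M (suc i) (suc j)) + (- M (suc i) zero) * sumFin k (λ j → M zero (suc j))
        ≡⟨ complete pivot (M (suc i) zero) _ _ ⟩
      pivot * sumFin (suc k) (M (suc i)) + (- M (suc i) zero) * sumFin (suc k) (M zero) ∎
      where
      open ≡-Reasoning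
      complete : ∀ p a X Y → p * X + (- a) * Y ≡ p * (a + X) + (- a) * (p + Y)
      complete = solve-∀

    condensed-rowSums : RowSumsNonNegative condensed
    condensed-rowSums i = subst (0ℤ ℤ.≤_) (sym (rowSum-condensed i))
      (ℤP.+-mono-≤ (*-nonNeg pivot-nonNeg (rows (suc i))) (*-nonNeg (0≤-M (λ ())) (rows zero)))

    module _ (0<pivot : 0ℤ ℤ.< pivot) where
      mutual
        condensed-linked : ∀ {i} → LinkedToDominantRow M (suc i) → LinkedToDominantRow condensed i
        condensed-linked {i} (dominant 0<row) = dominant (subst (0ℤ ℤ.<_) (sym (rowSum-condensed i))
          (ℤP.+-mono-<-≤ (*-pos 0<pivot 0<row) (*-nonNeg (0≤-M (λ ())) (rows zero))))
        condensed-linked (link zero Mᵢ₀<0 linked₀) = condensed-linked-via-pivot Mᵢ₀<0 linked₀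
        condensed-linked {i} (link (suc j) Mᵢⱼ<0 linkedⱼ) with i ≟ j
        ... | yes refl = condensed-linked linkedⱼ
        ... | no i≢j   = link j (ℤP.neg-cancel-< (subst (0ℤ ℤ.<_) (sym (-condensed≡ i j))
              (ℤP.+-mono-<-≤ (*-pos 0<pivot (ℤP.neg-mono-< Mᵢⱼ<0)) (*-nonNeg (0≤-M (λ ())) (0≤-M (λ ()))))))
            (condensed-linked linkedⱼ)

        condensed-linked-via-pivot : ∀ {i} → M (suc i) zero ℤ.< 0ℤ → LinkedToDominantRow M zero → LinkedToDominantRow condensed i
        condensed-linked-via-pivot {i} Mᵢ₀<0 (dominant 0<row) = dominant (subst (0ℤ ℤ.<_) (sym (rowSum-condensed i))
          (ℤP.+-mono-≤-< (*-nonNeg pivot-nonNeg (rows (suc i))) (*-pos (ℤP.neg-mono-< Mᵢ₀<0) 0<row)))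
        condensed-linked-via-pivot Mᵢ₀<0 (link zero M₀₀<0 _) = ⊥-elim (ℤP.<⇒≱ M₀₀<0 pivot-nonNeg)
        condensed-linked-via-pivot {i} Mᵢ₀<0 (link (suc j) M₀ⱼ<0 linkedⱼ) with i ≟ j
        ... | yes refl = condensed-linked linkedⱼ
        ... | no i≢j   = link j (ℤP.neg-cancel-< (subst (0ℤ ℤ.<_) (sym (-condensed≡ i j))
              (ℤP.+-mono-≤-< (*-nonNeg pivot-nonNeg (0≤-M (i≢j ∘ FinP.suc-injective)))
                             (*-pos (ℤP.neg-mono-< Mᵢ₀<0) (ℤP.neg-mono-< M₀ⱼ<0)))))
            (condensed-linked linkedⱼ)

  -- The hypotheses say that M is a weakly chained diagonally dominant Z-matrix. Chiò
  -- condensation on a positive pivot preserves this and scales the determinant positively.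
  det-pos : ∀ k (M : Matrix k) → OffDiagonalNonPositive M → RowSumsNonNegative M →
    (∀ i → LinkedToDominantRow M i) → 0ℤ ℤ.< det k M
  det-pos zero    M _   _    _      = +<+ (s≤s z≤n)
  det-pos (suc k) M off rows linked =
    *-pos-cancelˡ (det (suc k) M) (^-pos k 0<pivot)
      (subst (0ℤ ℤ.<_) (sym det-condensation)
        (*-pos 0<pivot (det-pos k condensed condensed-offDiagonal condensed-rowSums
                                (λ i → condensed-linked 0<pivot (linked (suc i))))))
    where
    open Condensation M
    open CondensationSigns M off rows
    0<pivot : 0ℤ ℤ.< pivot
    0<pivot = pivot-pos (linked zero)

  infix 4 _≡_mod_
  record _≡_mod_ (a b t : ℤ) : Set where
    constructor _,_
    field
      quotient : ℤ
      difference : a ≡ b + quotient * t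

  mod-reflexive : ∀ {t a b} → a ≡ b → a ≡ b mod t
  mod-reflexive {b = b} refl = 0ℤ , sym (ℤP.+-identityʳ b)

  mod-refl : ∀ {t} a → a ≡ a mod t
  mod-refl a = mod-reflexive refl

  mod-sym : ∀ {t a b} → a ≡ b mod t → b ≡ a mod t
  mod-sym {t} {b = b} (q , a≡) = - q , trans (shift b q t) (cong (_+ - q * t) (sym a≡))
    where
    shift : ∀ b q t → b ≡ b + q * t + - q * t
    shift = solve-∀

  mod-trans : ∀ {t a b c} → a ≡ b mod t → b ≡ c mod t → a ≡ c mod t
  mod-trans {t} {c = c} (q , a≡) (r , b≡) = r + q , trans a≡ (trans (cong (_+ q * t) b≡) (collect c r q t))
    where
    collect : ∀ c r q t → c + r * t + q * t ≡ c + (r + q) * t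
    collect = solve-∀

  mod-+ : ∀ {t a b c d} → a ≡ b mod t → c ≡ d mod t → a + c ≡ b + d mod t
  mod-+ {t} {b = b} {d = d} (q , a≡) (r , c≡) = q + r , trans (cong₂ _+_ a≡ c≡) (collect b q d r t)
    where
    collect : ∀ b q d r t → b + q * t + (d + r * t) ≡ b + d + (q + r) * t
    collect = solve-∀

  mod-* : ∀ {t a b c d} → a ≡ b mod t → c ≡ d mod t → a * c ≡ b * d mod t
  mod-* {t} {b = b} {d = d} (q , a≡) (r , c≡) = q * d + b * r + q * r * t , trans (cong₂ _*_ a≡ c≡) (collect b q d r t)
    where
    collect : ∀ b q d r t → (b + q * t) * (d + r * t) ≡ b * d + (q * d + b * r + q * r * t) * t
    collect = solve-∀

  mod-^ : ∀ {t a b} k → a ≡ b mod t → a ^ℤ k ≡ b ^ℤ k mod t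
  mod-^ zero    a≡b = mod-refl 1ℤ
  mod-^ (suc k) a≡b = mod-* a≡b (mod-^ k a≡b)

  mod-sumFin : ∀ {t} n (f g : Fin n → ℤ) → (∀ i → f i ≡ g i mod t) → sumFin n f ≡ sumFin n g mod t
  mod-sumFin zero    f g f≡g = mod-refl 0ℤ
  mod-sumFin (suc n) f g f≡g = mod-+ (f≡g zero) (mod-sumFin n (f ∘ suc) (g ∘ suc) (f≡g ∘ suc))

  mod-prodFin : ∀ {t} n (f g : Fin n → ℤ) → (∀ i → f i ≡ g i mod t) → prodFin n f ≡ prodFin n g mod t
  mod-prodFin zero    f g f≡g = mod-refl 1ℤ
  mod-prodFin (suc n) f g f≡g = mod-* (f≡g zero) (mod-prodFin n (f ∘ suc) (g ∘ suc) (f≡g ∘ suc))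

  mod-det : ∀ {t} n (M N : Matrix n) → (∀ i j → M i j ≡ N i j mod t) → det n M ≡ det n N mod t
  mod-det zero    M N M≡N = mod-refl 1ℤ
  mod-det (suc n) M N M≡N = mod-sumFin (suc n) _ _ λ j →
    mod-* (mod-* (mod-refl (sign (toℕ j))) (M≡N zero j)) (mod-det n (minor M j) (minor N j) (λ i k → M≡N (suc i) (punchIn j k)))

  mod-self : ∀ t → t ≡ 0ℤ mod t
  mod-self t = 1ℤ , sym (trans (ℤP.+-identityˡ (1ℤ * t)) (ℤP.*-identityˡ t))

  -- Take the modulus |a - b| + 1, which exceeds |a - b|.
  mod-all⇒≡ : ∀ a b → (∀ N → a ≡ b mod + suc N) → a ≡ b
  mod-all⇒≡ a b a≡b with a≡b ℤ.∣ a - b ∣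
  ... | q , a≡ = from-quotient q a≡ (trans (cong ℤ.∣_∣ (difference≡ a≡)) (ℤP.abs-* q (+ suc N)))
    where
    N : ℕ
    N = ℤ.∣ a - b ∣
    difference≡ : a ≡ b + q * + suc N → a - b ≡ q * + suc N
    difference≡ a≡ = trans (cong (_- b) a≡) (cancel b q (+ suc N))
      where
      cancel : ∀ b q t → b + q * t - b ≡ q * t
      cancel = solve-∀
    too-big : ∀ X → N ≢ suc (N ℕ.+ X)
    too-big X N≡ = ℕP.<-irrefl N≡ (s≤s (ℕP.m≤m+n N X))
    from-quotient : ∀ q → a ≡ b + q * + suc N → N ≡ ℤ.∣ q ∣ ℕ.* suc N → a ≡ b
    from-quotient (+ zero)  a≡ _  = trans a≡ (ℤP.+-identityʳ b)
    from-quotient (+ suc r) _  N≡ = ⊥-elim (too-big (r ℕ.* suc N) N≡)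
    from-quotient -[1+ r ]  _  N≡ = ⊥-elim (too-big (r ℕ.* suc N) N≡)

  -- Every integer polynomial has this property; it replaces a theory of polynomials here.
  CongruentToValueAtZero : (ℤ → ℤ) → Set
  CongruentToValueAtZero f = ∀ t → f t ≡ f 0ℤ mod t

  -- For t ≠ 0 cancel t and reduce modulo t: R(0) ≡ 0^(k-1)·S(0) for every modulus.
  t*R≡tᵏ*S⇒R₀≡S₀ : ∀ (R S : ℤ → ℤ) k → CongruentToValueAtZero R → CongruentToValueAtZero S →
    (∀ t → t * R t ≡ t ^ℤ k * S t) → R 0ℤ ≢ 0ℤ → S 0ℤ ≢ 0ℤ → R 0ℤ ≡ S 0ℤ
  t*R≡tᵏ*S⇒R₀≡S₀ R S zero    _    _    factor _    S₀≢0 =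
    ⊥-elim (S₀≢0 (trans (sym (ℤP.*-identityˡ (S 0ℤ))) (sym (factor 0ℤ))))
  t*R≡tᵏ*S⇒R₀≡S₀ R S (suc k) R≡R₀ S≡S₀ factor R₀≢0 _ =
    from-power k (mod-all⇒≡ (R 0ℤ) (0ℤ ^ℤ k * S 0ℤ) R₀≡0ᵏS₀)
    where
    R≡tᵏS : ∀ N → R (+ suc N) ≡ (+ suc N) ^ℤ k * S (+ suc N)
    R≡tᵏS N = ℤP.*-cancelˡ-≡ (+ suc N) (R (+ suc N)) _
                (trans (factor (+ suc N)) (ℤP.*-assoc (+ suc N) ((+ suc N) ^ℤ k) (S (+ suc N))))
    R₀≡0ᵏS₀ : ∀ N → R 0ℤ ≡ 0ℤ ^ℤ k * S 0ℤ mod + suc N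
    R₀≡0ᵏS₀ N = mod-trans (mod-sym (R≡R₀ (+ suc N)))
                  (mod-trans (mod-reflexive (R≡tᵏS N)) (mod-* (mod-^ k (mod-self (+ suc N))) (S≡S₀ (+ suc N))))
    from-power : ∀ k → R 0ℤ ≡ 0ℤ ^ℤ k * S 0ℤ → R 0ℤ ≡ S 0ℤ
    from-power zero    R₀≡ = trans R₀≡ (ℤP.*-identityˡ (S 0ℤ))
    from-power (suc k) R₀≡ = ⊥-elim (R₀≢0 R₀≡)

  module Bipartition {n : ℕ} (H : Graph n) (col : Fin n → Bool)
                     (proper : ∀ i j → adj H i j ≡ true → col i ≢ col j) where

    σ : Fin n → ℤ
    σ i = if col i then 1ℤ else ℤ.-1ℤ

    A : Matrix n
    A i j = + b2ℕ (adj H i j)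

    σ²≡1 : ∀ i → σ i * σ i ≡ 1ℤ
    σ²≡1 i with col i
    ... | true  = refl
    ... | false = refl

    σAσ≡-A : ∀ i j → σ i * A i j * σ j ≡ - A i j
    σAσ≡-A i j with adj H i j in i~j
    ... | false = cong (_* σ j) (ℤP.*-zeroʳ (σ i))
    ... | true with col i in ci | col j in cj
    ...   | true  | true  = ⊥-elim (proper i j i~j (trans ci (sym cj)))
    ...   | false | false = ⊥-elim (proper i j i~j (trans ci (sym cj)))
    ...   | true  | false = refl
    ...   | false | true  = refl

    Aσ≡-σA : ∀ i j → A i j * σ j ≡ - (σ i * A i j)
    Aσ≡-σA i j with adj H i j in i~j
    ... | false = sym (cong -_ (ℤP.*-zeroʳ (σ i)))
    ... | true with col i in ci | col j in cj
    ...   | true  | true  = ⊥-elim (proper i j i~j (trans ci (sym cj)))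
    ...   | false | false = ⊥-elim (proper i j i~j (trans ci (sym cj)))
    ...   | true  | false = refl
    ...   | false | true  = refl

    Qσ≡0 : ∀ i → sumFin n (λ j → Q H i j * σ j) ≡ 0ℤ
    Qσ≡0 i = begin
      sumFin n (λ j → (δ i j d + A i j) * σ j)
        ≡⟨ sumFin-cong n (λ j → ℤP.*-distribʳ-+ (σ j) (δ i j d) (A i j)) ⟩
      sumFin n (λ j → δ i j d * σ j + A i j * σ j)
        ≡⟨ sumFin-+ n (λ j → δ i j d * σ j) (λ j → A i j * σ j) ⟩
      sumFin n (λ j → δ i j d * σ j) + sumFin n (λ j → A i j * σ j)
        ≡⟨ cong₂ _+_ (trans (sumFin-cong n (λ j → δ-*ʳ i j d (σ j))) (sumFin-δʳ n i (λ j → d * σ j)))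
                     (trans (sumFin-cong n (Aσ≡-σA i))
                            (trans (sumFin-neg n (λ j → σ i * A i j)) (cong -_ (sumFin-*ˡ n (σ i) (A i))))) ⟩
      d * σ i + - (σ i * sumFin n (A i))
        ≡⟨ cong (λ x → d * σ i + - (σ i * x)) (sumFinℕ-ℤ n (λ j → b2ℕ (adj H i j))) ⟨
      d * σ i + - (σ i * d)
        ≡⟨ cancel d (σ i) ⟩
      0ℤ ∎
      where
      open ≡-Reasoning
      d : ℤ
      d = + degree H i
      cancel : ∀ d s → d * s + - (s * d) ≡ 0ℤ
      cancel = solve-∀

    Q-sym : ∀ i j → Q H i j ≡ Q H j i
    Q-sym i j = by-cases (i ≟ j)
      where
      by-cases : Dec (i ≡ j) → Q H i j ≡ Q H j i
      by-cases (yes refl) = refl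
      by-cases (no i≢j)   = cong₂ _+_ (trans (δ-≢ _ i≢j) (sym (δ-≢ _ (i≢j ∘ sym)))) (cong (+_ ∘ b2ℕ) (Graph.sym H i j))

    σQ≡0 : ∀ j → sumFin n (λ i → σ i * Q H i j) ≡ 0ℤ
    σQ≡0 j = trans (sumFin-cong n (λ i → trans (ℤP.*-comm (σ i) (Q H i j)) (cong (_* σ i) (Q-sym i j)))) (Qσ≡0 j)

  module ReducedCharPoly {m : ℕ} (H : Graph (suc m)) (col : Fin (suc m) → Bool)
                         (proper : ∀ i j → adj H i j ≡ true → col i ≢ col j) where
    open Bipartition H col proper

    u : Fin (suc m) → ℤ
    u j = σ zero * σ j

    tI-Q : ℤ → Matrix (suc m)
    tI-Q t i j = δ i j t - Q H i j

    -- u is a kernel vector of Q with u zero = 1, so replacing the first row of tI - Q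
    -- by u divides its determinant by t.
    R : ℤ → ℤ
    R t = det (suc m) (setRow (tI-Q t) zero u)

    u·[tI-Q]≡t*u : ∀ t j → sumFin (suc m) (λ i → u i * tI-Q t i j) ≡ t * u j
    u·[tI-Q]≡t*u t j = begin
      sumFin (suc m) (λ i → u i * (δ i j t - Q H i j))
        ≡⟨ sumFin-cong (suc m) (λ i → trans (expand (σ zero) (σ i) (δ i j t) (Q H i j))
                                            (cong (_+ - (σ zero * (σ i * Q H i j))) (δ-*ˡ i j t (u i)))) ⟩
      sumFin (suc m) (λ i → δ i j (u i * t) + - (σ zero * (σ i * Q H i j)))
        ≡⟨ sumFin-+ (suc m) (λ i → δ i j (u i * t)) (λ i → - (σ zero * (σ i * Q H i j))) ⟩
      sumFin (suc m) (λ i → δ i j (u i * t)) + sumFin (suc m) (λ i → - (σ zero * (σ i * Q H i j)))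
        ≡⟨ cong₂ _+_ (sumFin-δˡ (suc m) j (λ i → u i * t))
             (trans (sumFin-neg (suc m) (λ i → σ zero * (σ i * Q H i j)))
               (cong -_ (trans (sumFin-*ˡ (suc m) (σ zero) (λ i → σ i * Q H i j)) (cong (σ zero *_) (σQ≡0 j))))) ⟩
      u j * t + - (σ zero * 0ℤ)
        ≡⟨ simplify (u j) t (σ zero) ⟩
      t * u j ∎
      where
      open ≡-Reasoning
      expand : ∀ a b x q → a * b * (x - q) ≡ a * b * x + - (a * (b * q))
      expand = solve-∀
      simplify : ∀ x t s → x * t + - (s * 0ℤ) ≡ t * x
      simplify = solve-∀

    charPoly≡t*R : ∀ t → charPolyAt (suc m) (Q H) t ≡ t * R t
    charPoly≡t*R t = begin
      det (suc m) (tI-Q t)                  ≡⟨ ℤP.*-identityˡ _ ⟨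
      1ℤ * det (suc m) (tI-Q t)             ≡⟨ cong (_* det (suc m) (tI-Q t)) (σ²≡1 zero) ⟨
      u zero * det (suc m) (tI-Q t)         ≡⟨ det-setRow₀-combination m (tI-Q t) u ⟨
      det (suc m) (setRow (tI-Q t) zero (λ j → sumFin (suc m) (λ i → u i * tI-Q t i j)))
        ≡⟨ det-cong (suc m) {M = setRow (tI-Q t) zero (λ j → sumFin (suc m) (λ i → u i * tI-Q t i j))}
                            {N = setRow (tI-Q t) zero (λ j → t * u j + 0ℤ * u j)}
             (λ { zero j → trans (u·[tI-Q]≡t*u t j) (sym (ℤP.+-identityʳ (t * u j))) ; (suc i) j → refl }) ⟩
      det (suc m) (setRow (tI-Q t) zero (λ j → t * u j + 0ℤ * u j))
        ≡⟨ det-setRow-linear (suc m) (tI-Q t) zero t 0ℤ u u ⟩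
      t * R t + 0ℤ * R t                    ≡⟨ ℤP.+-identityʳ _ ⟩
      t * R t                               ∎
      where open ≡-Reasoning

    R₀≡n*det[-Q₁₁] : R 0ℤ ≡ + suc m * det m (λ a b → - Q H (suc a) (suc b))
    R₀≡n*det[-Q₁₁] = begin
      det (suc m) V                               ≡⟨ det-transpose (suc m) V ⟨
      det (suc m) (transpose V)                   ≡⟨ ℤP.*-identityˡ _ ⟨
      1ℤ * det (suc m) (transpose V)              ≡⟨ cong (_* det (suc m) (transpose V)) (σ²≡1 zero) ⟨
      u zero * det (suc m) (transpose V)          ≡⟨ det-setRow₀-combination m (transpose V) u ⟨
      det (suc m) (setRow (transpose V) zero (λ j → sumFin (suc m) (λ i → u i * V j i)))
        ≡⟨ det-cong (suc m) {M = setRow (transpose V) zero (λ j → sumFin (suc m) (λ i → u i * V j i))}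
                            {N = setRow (transpose V) zero e₀} (λ { zero j → V·u≡e₀ j ; (suc i) j → refl }) ⟩
      det (suc m) (setRow (transpose V) zero e₀)  ≡⟨ det-transpose (suc m) (setRow (transpose V) zero e₀) ⟨
      det (suc m) (transpose (setRow (transpose V) zero e₀))
        ≡⟨ det-zeroBelowPivot m (transpose (setRow (transpose V) zero e₀)) (λ _ → refl) ⟩
      + suc m * det m (λ a b → V (suc a) (suc b))
        ≡⟨ cong (+ suc m *_) (det-cong m (λ a b → cong (_- Q H (suc a) (suc b)) (δ-0 (suc a) (suc b)))) ⟩
      + suc m * det m (λ a b → 0ℤ - Q H (suc a) (suc b)) ≡⟨ cong (+ suc m *_) (det-cong m (λ a b → ℤP.+-identityˡ _)) ⟩
      + suc m * det m (λ a b → - Q H (suc a) (suc b)) ∎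
      where
      open ≡-Reasoning
      V : Matrix (suc m)
      V = setRow (tI-Q 0ℤ) zero u
      e₀ : Fin (suc m) → ℤ
      e₀ zero    = + suc m
      e₀ (suc j) = 0ℤ
      V·u≡e₀ : ∀ j → sumFin (suc m) (λ i → u i * V j i) ≡ e₀ j
      V·u≡e₀ zero    = trans (sumFin-cong (suc m) (λ i → trans (square (σ zero) (σ i)) (cong₂ _*_ (σ²≡1 zero) (σ²≡1 i))))
                             (sumFin-const-1 (suc m))
        where
        square : ∀ a b → a * b * (a * b) ≡ (a * a) * (b * b)
        square = solve-∀
      V·u≡e₀ (suc j) = begin
        sumFin (suc m) (λ i → u i * (δ (suc j) i 0ℤ - Q H (suc j) i))
          ≡⟨ sumFin-cong (suc m) (λ i → trans (cong (λ x → u i * (x - Q H (suc j) i)) (δ-0 (suc j) i))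
                                              (pull (σ zero) (σ i) (Q H (suc j) i))) ⟩
        sumFin (suc m) (λ i → - (σ zero * (Q H (suc j) i * σ i)))
          ≡⟨ sumFin-neg (suc m) (λ i → σ zero * (Q H (suc j) i * σ i)) ⟩
        - sumFin (suc m) (λ i → σ zero * (Q H (suc j) i * σ i))
          ≡⟨ cong -_ (trans (sumFin-*ˡ (suc m) (σ zero) (λ i → Q H (suc j) i * σ i)) (cong (σ zero *_) (Qσ≡0 (suc j)))) ⟩
        - (σ zero * 0ℤ) ≡⟨ cong -_ (ℤP.*-zeroʳ (σ zero)) ⟩
        0ℤ ∎
        where
        pull : ∀ a b q → a * b * (0ℤ - q) ≡ - (a * (q * b))
        pull = solve-∀

    R-congruent : CongruentToValueAtZero R
    R-congruent t = mod-det (suc m) _ _ entry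
      where
      entry : ∀ i j → setRow (tI-Q t) zero u i j ≡ setRow (tI-Q 0ℤ) zero u i j mod t
      entry zero    j = mod-refl (u j)
      entry (suc i) j = mod-+ (δ-mod (suc i) j) (mod-refl (- Q H (suc i) j))
        where
        δ-mod : ∀ i j → δ i j t ≡ δ i j 0ℤ mod t
        δ-mod i j with does (i ≟ j)
        ... | true  = mod-self t
        ... | false = mod-refl 0ℤ

    det[-Q₁₁]≢0 : (∀ i j → Reachable H i j) → det m (λ a b → - Q H (suc a) (suc b)) ≢ 0ℤ
    det[-Q₁₁]≢0 connected det≡0 = ℤP.<-irrefl (sym (detL≡ det≡0)) 0<detL
      where
      L : Matrix m
      L a b = σ (suc a) * Q H (suc a) (suc b) * σ (suc b)

      L-offDiagonal : ∀ a b → a ≢ b → L a b ≡ - A (suc a) (suc b)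
      L-offDiagonal a b a≢b = begin
        σ (suc a) * (δ (suc a) (suc b) (+ degree H (suc a)) + A (suc a) (suc b)) * σ (suc b)
          ≡⟨ cong (λ x → σ (suc a) * (x + A (suc a) (suc b)) * σ (suc b)) (δ-≢ _ (a≢b ∘ FinP.suc-injective)) ⟩
        σ (suc a) * (0ℤ + A (suc a) (suc b)) * σ (suc b)
          ≡⟨ cong (λ x → σ (suc a) * x * σ (suc b)) (ℤP.+-identityˡ _) ⟩
        σ (suc a) * A (suc a) (suc b) * σ (suc b)
          ≡⟨ σAσ≡-A (suc a) (suc b) ⟩
        - A (suc a) (suc b) ∎
        where open ≡-Reasoning

      rowSum-L : ∀ a → sumFin m (L a) ≡ A (suc a) zero
      rowSum-L a = begin
        sumFin m (L a)
          ≡⟨ trans (sumFin-cong m (λ b → ℤP.*-assoc (σ (suc a)) _ _))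
                   (sumFin-*ˡ m (σ (suc a)) (λ b → Q H (suc a) (suc b) * σ (suc b))) ⟩
        σ (suc a) * sumFin m (λ b → Q H (suc a) (suc b) * σ (suc b))
          ≡⟨ cong (σ (suc a) *_) (ℤ+.inverseʳ-unique _ _ (Qσ≡0 (suc a))) ⟩
        σ (suc a) * - (Q H (suc a) zero * σ zero)
          ≡⟨ cong (λ x → σ (suc a) * - (x * σ zero)) (ℤP.+-identityˡ (A (suc a) zero)) ⟩
        σ (suc a) * - (A (suc a) zero * σ zero)
          ≡⟨ pull (σ (suc a)) (A (suc a) zero) (σ zero) ⟩
        - (σ (suc a) * A (suc a) zero * σ zero)
          ≡⟨ cong -_ (σAσ≡-A (suc a) zero) ⟩
        - - A (suc a) zero
          ≡⟨ ℤP.neg-involutive _ ⟩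
        A (suc a) zero ∎
        where
        open ≡-Reasoning
        pull : ∀ s a t → s * - (a * t) ≡ - (s * a * t)
        pull = solve-∀

      linked : ∀ a → Reachable H (suc a) zero → LinkedToDominantRow L a
      linked a (step {j = zero} a~0 _) =
        dominant (subst (0ℤ ℤ.<_) (sym (rowSum-L a)) (subst (λ e → 0ℤ ℤ.< + b2ℕ e) (sym a~0) (+<+ (s≤s z≤n))))
      linked a (step {j = suc b} a~b walk) = link b L<0 (linked b walk)
        where
        a≢b : a ≢ b
        a≢b refl with () ← trans (sym a~b) (Graph.irrefl H (suc a))
        L<0 : L a b ℤ.< 0ℤ
        L<0 = subst (ℤ._< 0ℤ) (sym (trans (L-offDiagonal a b a≢b) (cong (λ e → - + b2ℕ e) a~b))) -<+

      0<detL : 0ℤ ℤ.< det m L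
      0<detL = det-pos m L (λ a b a≢b → subst (ℤ._≤ 0ℤ) (sym (L-offDiagonal a b a≢b)) ℤP.neg-≤-pos)
                       (λ a → subst (0ℤ ℤ.≤_) (sym (rowSum-L a)) (+≤+ z≤n))
                       (λ a → linked a (connected (suc a) zero))

      detL≡ : det m (λ a b → - Q H (suc a) (suc b)) ≡ 0ℤ → det m L ≡ 0ℤ
      detL≡ det≡0 = begin
        det m L ≡⟨ det-cong m (λ a b → flip (σ (suc a)) (Q H (suc a) (suc b)) (σ (suc b))) ⟩
        det m (λ a b → σ (suc a) * - Q H (suc a) (suc b) * - σ (suc b))
          ≡⟨ det-scaleColumns m (λ a b → σ (suc a) * - Q H (suc a) (suc b)) (λ b → - σ (suc b)) ⟩
        prodFin m (λ b → - σ (suc b)) * det m (λ a b → σ (suc a) * - Q H (suc a) (suc b))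
          ≡⟨ cong (prodFin m (λ b → - σ (suc b)) *_) (det-scaleRows m (λ a b → - Q H (suc a) (suc b)) (σ ∘ suc)) ⟩
        prodFin m (λ b → - σ (suc b)) * (prodFin m (σ ∘ suc) * det m (λ a b → - Q H (suc a) (suc b)))
          ≡⟨ cong (λ d → prodFin m (λ b → - σ (suc b)) * (prodFin m (σ ∘ suc) * d)) det≡0 ⟩
        prodFin m (λ b → - σ (suc b)) * (prodFin m (σ ∘ suc) * 0ℤ)
          ≡⟨ trans (cong (prodFin m (λ b → - σ (suc b)) *_) (ℤP.*-zeroʳ (prodFin m (σ ∘ suc))))
                   (ℤP.*-zeroʳ (prodFin m (λ b → - σ (suc b)))) ⟩
        0ℤ ∎
        where
        open ≡-Reasoning
        flip : ∀ s q t → s * q * t ≡ s * - q * - t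
        flip = solve-∀

  nonzeroPart : (Fin 6 → ℕ) → ℤ → ℤ
  nonzeroPart m t = prodFin 5 (λ r → (t - + toℕ (suc r)) ^ℤ m (suc r))

  charPoly≡tᵐ⁰*nonzeroPart : ∀ n (M : Matrix n) m → SpectrumIn0to5 n M m →
    ∀ t → charPolyAt n M t ≡ t ^ℤ m zero * nonzeroPart m t
  charPoly≡tᵐ⁰*nonzeroPart n M m spectrum t =
    trans (spectrum t) (cong (λ x → x ^ℤ m zero * nonzeroPart m t) (ℤP.+-identityʳ t))

  nonzeroPart-congruent : ∀ m → CongruentToValueAtZero (nonzeroPart m)
  nonzeroPart-congruent m t = mod-prodFin 5 _ _ (λ r → mod-^ (m (suc r)) (mod-+ (mod-self t) (mod-refl (- + toℕ (suc r)))))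

  nonzeroPart-0≢0 : ∀ m → nonzeroPart m 0ℤ ≢ 0ℤ
  nonzeroPart-0≢0 m = prod≢0 5 _ (λ r → pow≢0 (m (suc r)) (root≢0 r))
    where
    root≢0 : ∀ (r : Fin 5) → 0ℤ - + toℕ (suc r) ≢ 0ℤ
    root≢0 r ()
    pow≢0 : ∀ {x} k → x ≢ 0ℤ → x ^ℤ k ≢ 0ℤ
    pow≢0 zero    x≢0 ()
    pow≢0 (suc k) x≢0 xᵏ⁺¹≡0 with ℤP.i*j≡0⇒i≡0∨j≡0 _ xᵏ⁺¹≡0
    ... | inj₁ x≡0  = x≢0 x≡0
    ... | inj₂ xᵏ≡0 = pow≢0 k x≢0 xᵏ≡0
    prod≢0 : ∀ n (f : Fin n → ℤ) → (∀ i → f i ≢ 0ℤ) → prodFin n f ≢ 0ℤ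
    prod≢0 zero    f f≢0 ()
    prod≢0 (suc n) f f≢0 ∏≡0 with ℤP.i*j≡0⇒i≡0∨j≡0 (f zero) ∏≡0
    ... | inj₁ f₀≡0 = f≢0 zero f₀≡0
    ... | inj₂ ∏≡0′ = prod≢0 n (f ∘ suc) (f≢0 ∘ suc) ∏≡0′

  ∣nonzeroPart-0∣ : ∀ m →
    ℤ.∣ nonzeroPart m 0ℤ ∣ ≡ 2 ℕ.^ (m (# 2) ℕ.+ 2 ℕ.* m (# 4)) ℕ.* 3 ℕ.^ m (# 3) ℕ.* 5 ℕ.^ m (# 5)
  ∣nonzeroPart-0∣ m = begin
    ℤ.∣ nonzeroPart m 0ℤ ∣
      ≡⟨ ∣^*∣ (# 0) _ (∣^*∣ (# 1) _ (∣^*∣ (# 2) _ (∣^*∣ (# 3) _ (∣^*∣ (# 4) 1 refl)))) ⟩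
    1 ℕ.^ m (# 1) ℕ.* (2 ℕ.^ m₂ ℕ.* (3 ℕ.^ m₃ ℕ.* (4 ℕ.^ m₄ ℕ.* (5 ℕ.^ m₅ ℕ.* 1))))
      ≡⟨ cong (ℕ._* (2 ℕ.^ m₂ ℕ.* (3 ℕ.^ m₃ ℕ.* (4 ℕ.^ m₄ ℕ.* (5 ℕ.^ m₅ ℕ.* 1))))) (ℕP.^-zeroˡ (m (# 1))) ⟩
    1 ℕ.* (2 ℕ.^ m₂ ℕ.* (3 ℕ.^ m₃ ℕ.* (4 ℕ.^ m₄ ℕ.* (5 ℕ.^ m₅ ℕ.* 1))))
      ≡⟨ rearrange (2 ℕ.^ m₂) (3 ℕ.^ m₃) (4 ℕ.^ m₄) (5 ℕ.^ m₅) ⟩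
    2 ℕ.^ m₂ ℕ.* 4 ℕ.^ m₄ ℕ.* 3 ℕ.^ m₃ ℕ.* 5 ℕ.^ m₅
      ≡⟨ cong (λ x → 2 ℕ.^ m₂ ℕ.* x ℕ.* 3 ℕ.^ m₃ ℕ.* 5 ℕ.^ m₅) (ℕP.^-*-assoc 2 2 m₄) ⟩
    2 ℕ.^ m₂ ℕ.* 2 ℕ.^ (2 ℕ.* m₄) ℕ.* 3 ℕ.^ m₃ ℕ.* 5 ℕ.^ m₅
      ≡⟨ cong (λ x → x ℕ.* 3 ℕ.^ m₃ ℕ.* 5 ℕ.^ m₅) (ℕP.^-distribˡ-+-* 2 m₂ (2 ℕ.* m₄)) ⟨
    2 ℕ.^ (m₂ ℕ.+ 2 ℕ.* m₄) ℕ.* 3 ℕ.^ m₃ ℕ.* 5 ℕ.^ m₅ ∎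
    where
    open ≡-Reasoning
    m₂ m₃ m₄ m₅ : ℕ
    m₂ = m (# 2)
    m₃ = m (# 3)
    m₄ = m (# 4)
    m₅ = m (# 5)
    f : Fin 5 → ℤ
    f r = (0ℤ - + toℕ (suc r)) ^ℤ m (suc r)
    ∣^*∣ : ∀ r y {z} → ℤ.∣ z ∣ ≡ y → ℤ.∣ f r * z ∣ ≡ toℕ (suc r) ℕ.^ m (suc r) ℕ.* y
    ∣^*∣ r y ∣z∣≡y = trans (ℤP.abs-* (f r) _) (cong₂ ℕ._*_ (∣xᵏ∣ (0ℤ - + toℕ (suc r)) (m (suc r))) ∣z∣≡y)
      where
      ∣xᵏ∣ : ∀ x k → ℤ.∣ x ^ℤ k ∣ ≡ ℤ.∣ x ∣ ℕ.^ k
      ∣xᵏ∣ x zero    = refl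
      ∣xᵏ∣ x (suc k) = trans (ℤP.abs-* x (x ^ℤ k)) (cong (ℤ.∣ x ∣ ℕ.*_) (∣xᵏ∣ x k))
    rearrange : ∀ a b d c → 1 ℕ.* (a ℕ.* (b ℕ.* (d ℕ.* (c ℕ.* 1)))) ≡ a ℕ.* d ℕ.* b ℕ.* c
    rearrange = ℕ-Solver.solve-∀

  vertexCount∣ : ∀ n (H : Graph n) → Connected H → Bipartite H → (m : Fin 6 → ℕ) → SpectrumIn0to5 n (Q H) m →
    n ∣ 2 ℕ.^ (m (# 2) ℕ.+ 2 ℕ.* m (# 4)) ℕ.* 3 ℕ.^ m (# 3) ℕ.* 5 ℕ.^ m (# 5)
  vertexCount∣ zero    H (() , _)
  vertexCount∣ (suc k) H (_ , connected) (col , proper) m spectrum =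
    divides ℤ.∣ cofactor ∣ (begin
      2 ℕ.^ (m (# 2) ℕ.+ 2 ℕ.* m (# 4)) ℕ.* 3 ℕ.^ m (# 3) ℕ.* 5 ℕ.^ m (# 5) ≡⟨ ∣nonzeroPart-0∣ m ⟨
      ℤ.∣ nonzeroPart m 0ℤ ∣                                         ≡⟨ cong ℤ.∣_∣ R₀≡S₀ ⟨
      ℤ.∣ R 0ℤ ∣                                                     ≡⟨ cong ℤ.∣_∣ R₀≡n*det[-Q₁₁] ⟩
      ℤ.∣ + suc k * cofactor ∣                                       ≡⟨ ℤP.abs-* (+ suc k) cofactor ⟩
      suc k ℕ.* ℤ.∣ cofactor ∣                                       ≡⟨ ℕP.*-comm (suc k) _ ⟩
      ℤ.∣ cofactor ∣ ℕ.* suc k                                       ∎)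
    where
    open ≡-Reasoning
    open ReducedCharPoly H col proper
    cofactor : ℤ
    cofactor = det k (λ a b → - Q H (suc a) (suc b))
    R₀≢0 : R 0ℤ ≢ 0ℤ
    R₀≢0 R₀≡0 = [ (λ ()) , det[-Q₁₁]≢0 connected ]′
                  (ℤP.i*j≡0⇒i≡0∨j≡0 (+ suc k) (trans (sym R₀≡n*det[-Q₁₁]) R₀≡0))
    R₀≡S₀ : R 0ℤ ≡ nonzeroPart m 0ℤ
    R₀≡S₀ = t*R≡tᵏ*S⇒R₀≡S₀ R (nonzeroPart m) (m zero) R-congruent (nonzeroPart-congruent m)
              (λ t → trans (sym (charPoly≡t*R t)) (charPoly≡tᵐ⁰*nonzeroPart (suc k) (Q H) m spectrum t))
              R₀≢0 (nonzeroPart-0≢0 m)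

open import Data.Nat using (_+_; _*_; _^_; _≤_)

∣p*m⇒ : ∀ {p n m} → Prime p → n ∣ p * m → (Σ ℕ λ n′ → n ≡ p * n′ × n′ ∣ m) ⊎ n ∣ m
∣p*m⇒ {p} {n} p-prime n∣pm with p ∣? n
... | yes (divides n′ n≡n′p) = inj₁ (n′ , n≡pn′ , *-cancelˡ-∣ p {{prime⇒nonZero p-prime}} (subst (_∣ p * _) n≡pn′ n∣pm))
  where
  n≡pn′ : n ≡ p * n′
  n≡pn′ = trans n≡n′p (ℕP.*-comm n′ p)
... | no p∤n = inj₂ (coprime-divisor coprime n∣pm)
  where
  coprime : ∀ {d} → d ∣ n × d ∣ p → d ≡ 1
  coprime (d∣n , d∣p) with prime⇒irreducible p-prime d∣p
  ... | inj₁ d≡1 = d≡1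
  ... | inj₂ refl = ⊥-elim (p∤n d∣n)

∣pᴬ*m⇒ : ∀ {p} → Prime p → ∀ A {n m} → n ∣ p ^ A * m →
  Σ ℕ λ a → Σ ℕ λ n′ → n ≡ p ^ a * n′ × a ≤ A × n′ ∣ m
∣pᴬ*m⇒ p-prime zero    {n} n∣m = 0 , n , sym (ℕP.*-identityˡ n) , z≤n , subst (n ∣_) (ℕP.*-identityˡ _) n∣m
∣pᴬ*m⇒ {p} p-prime (suc A) {n} {m} n∣pᴬ⁺¹m with ∣p*m⇒ p-prime (subst (n ∣_) (ℕP.*-assoc p (p ^ A) m) n∣pᴬ⁺¹m)
... | inj₂ n∣pᴬm with ∣pᴬ*m⇒ p-prime A n∣pᴬm
...   | a , n′ , n≡ , a≤A , n′∣m = a , n′ , n≡ , ℕP.m≤n⇒m≤1+n a≤A , n′∣m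
∣pᴬ*m⇒ {p} p-prime (suc A) {n} {m} _ | inj₁ (q , n≡pq , q∣pᴬm) with ∣pᴬ*m⇒ p-prime A q∣pᴬm
...   | a , n′ , q≡ , a≤A , n′∣m =
  suc a , n′ , trans n≡pq (trans (cong (p *_) q≡) (sym (ℕP.*-assoc p (p ^ a) n′))) , s≤s a≤A , n′∣m

prime[3] : Prime 3
prime[3] = from-yes (prime? 3)

prime[5] : Prime 5
prime[5] = from-yes (prime? 5)

*-assoc₃ : ∀ x y z → x * y * z ≡ x * (y * (z * 1))
*-assoc₃ = ℕ-Solver.solve-∀

∣2ᴬ3ᴮ5ᶜ⇒ : ∀ {n A B C} → n ∣ 2 ^ A * 3 ^ B * 5 ^ C →
  Σ ℕ λ a → Σ ℕ λ b → Σ ℕ λ c → (n ≡ 2 ^ a * 3 ^ b * 5 ^ c) × a ≤ A × b ≤ B × c ≤ C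
∣2ᴬ3ᴮ5ᶜ⇒ {n} {A} {B} {C} n∣ with ∣pᴬ*m⇒ prime[2] A (subst (n ∣_) (*-assoc₃ (2 ^ A) (3 ^ B) (5 ^ C)) n∣)
... | a , n₁ , n≡ , a≤A , n₁∣ with ∣pᴬ*m⇒ prime[3] B n₁∣
...   | b , n₂ , n₁≡ , b≤B , n₂∣ with ∣pᴬ*m⇒ prime[5] C n₂∣
...     | c , n₃ , n₂≡ , c≤C , n₃∣1 rewrite n≡ | n₁≡ | n₂≡ | ∣1⇒≡1 n₃∣1 =
  a , b , c , sym (*-assoc₃ (2 ^ a) (3 ^ b) (5 ^ c)) , a≤A , b≤B , c≤C

corollary3p10 : (n : ℕ) (H : Graph n) → Connected H → Bipartite H →
    (m : Fin 6 → ℕ) → SpectrumIn0to5 n (Q H) m →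
    Σ ℕ λ a → Σ ℕ λ b → Σ ℕ λ c →
      (n ≡ 2 ^ a * 3 ^ b * 5 ^ c) ×
      (a ≤ m (Fin.suc (Fin.suc Fin.zero)) + 2 * m (Fin.suc (Fin.suc (Fin.suc (Fin.suc Fin.zero))))) ×
      (b ≤ m (Fin.suc (Fin.suc (Fin.suc Fin.zero)))) ×
      (c ≤ m (Fin.suc (Fin.suc (Fin.suc (Fin.suc (Fin.suc Fin.zero))))))
corollary3p10 n H connected bipartite m spectrum = ∣2ᴬ3ᴮ5ᶜ⇒ (vertexCount∣ n H connected bipartite m spectrum)
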